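{- Let $n>0$ and let $\mathcal{P}=(P_1,\dots,P_n)$ be a family of lattice polytopes in $\mathbb{R}^d$ with $0\in P_i$ for all $i$. Then \[ (-1)^n\,\mathrm{CM}E(P_1,\dots,P_n)\;=\;\sum_{\mu\in P_{[n]}\cap\mathbb{Z}^d}\tilde\chi\bigl(\Delta(\mathcal{P};\mu)\bigr), \] where $\tilde\chi$ denotes the reduced Euler characteristic.
   Context: A lattice polytope is the convex hull of finitely many points of $\mathbb{Z}^d$. For $I\subseteq[n]=\{1,\dots,n\}$ write $P_I=\sum_{i\in I}P_i=\{\sum_{i\in I}p_i: p_i\in P_i\}$ (Minkowski sum), with $P_\emptyset=\{0\}$. For $S\subset\mathbb{R}^d$ let $E(S)=|S\cap\mathbb{Z}^d|$. The discrete mixed volume is $\mathrm{CM}E(P_1,\dots,P_n)=\sum_{I\subseteq[n]}(-1)^{n-|I|}E(P_I)$. For $\mu\in\mathbb{R}^d$, the Minkowski complex $\Delta(\mathcal{P};\mu)$ is the simplicial complex consisting of all $\sigma\subseteq[n]$ with $\mu\notin P_\sigma$. The reduced Euler characteristic of a simplicial complex $\Delta$ is $\tilde\chi(\Delta)=\sum_{\sigma\in\Delta}(-1)^{|\sigma|-1}$ (the empty face contributing $-1$); with the sign convention of the formula this equals $-\sum_{\sigma\in\Delta}(-1)^{|\sigma|}$. -}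

module Defs where

open import Data.Nat as ℕ using (ℕ; zero; suc)
open import Data.Integer as ℤ using (ℤ; +_; -_)
open import Data.Rational as ℚ using (ℚ; 0ℚ; 1ℚ; _≤_)
open import Data.Fin using (Fin; zero; suc)
open import Data.Fin.Subset using (Subset; _∈_; _∉_; ∣_∣; inside; outside)
open import Data.Vec as V using (Vec; []; _∷_; lookup)
open import Data.List as L using (List; []; _∷_; length)
open import Data.Bool using (Bool; true; false; if_then_else_)
open import Data.Product using (Σ; _×_; ∃)
open import Data.Vec.Properties using (≡-dec)
open import Relation.Binary.PropositionalEquality using (_≡_)
open import Relation.Nullary using (does)
import Data.List.Membership.DecPropositional as DecMem

Pt : ℕ → Set
Pt d = Vec ℤ d

QPt : ℕ → Set
QPt d = Vec ℚ d

toℚ : ∀ {d} → Pt d → QPt d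
toℚ = V.map (λ z → z ℚ./ 1)

zeroQ : ∀ {d} → QPt d
zeroQ = V.replicate _ 0ℚ

_+Q_ : ∀ {d} → QPt d → QPt d → QPt d
_+Q_ = V.zipWith ℚ._+_

_·Q_ : ∀ {d} → ℚ → QPt d → QPt d
c ·Q v = V.map (c ℚ.*_) v

sumQ : ∀ {d k} → (Fin k → QPt d) → QPt d
sumQ {k = zero}  f = zeroQ
sumQ {k = suc k} f = f zero +Q sumQ (λ j → f (suc j))

sumℚ : ∀ {k} → (Fin k → ℚ) → ℚ
sumℚ {zero}  f = 0ℚ
sumℚ {suc k} f = f zero ℚ.+ sumℚ (λ j → f (suc j))

-- A lattice polytope is presented as conv(V) for a finite list V of lattice points.
-- x ∈ conv(V): x is a convex combination of the points of V.
InConv : ∀ {d} → List (Pt d) → QPt d → Set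
InConv {d} Vs x =
  Σ (Fin (length Vs) → ℚ) λ c →
    (∀ j → 0ℚ ≤ c j) × (sumℚ c ≡ 1ℚ) ×
    (sumQ (λ j → c j ·Q toℚ (L.lookup Vs j)) ≡ x)

-- x ∈ P_I = Σ_{i∈I} P_i (Minkowski sum; P_∅ = {0}).
InMinkowski : ∀ {d n} → (Fin n → List (Pt d)) → Subset n → QPt d → Set
InMinkowski {d} {n} P I x =
  Σ (Fin n → QPt d) λ p →
    (∀ i → i ∈ I → InConv (P i) (p i)) ×
    (sumQ (λ i → if lookup I i then p i else zeroQ) ≡ x)

allSubsets : (n : ℕ) → List (Subset n)
allSubsets zero    = [] ∷ []
allSubsets (suc n) = L.map (outside ∷_) (allSubsets n) L.++ L.map (inside ∷_) (allSubsets n)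

sgn : ℕ → ℤ
sgn zero    = + 1
sgn (suc k) = - sgn k

sumℤ : ∀ {A : Set} → List A → (A → ℤ) → ℤ
sumℤ xs f = L.foldr (λ a acc → f a ℤ.+ acc) (+ 0) xs

-- Given an enumeration Lat I of the lattice points of P_I (for each I):
-- discrete mixed volume CME = Σ_I (-1)^{n-|I|} E(P_I)
CME : ∀ {d n} → (Subset n → List (Pt d)) → ℤ
CME {n = n} Lat = sumℤ (allSubsets n) λ I → sgn (n ℕ.∸ ∣ I ∣) ℤ.* (+ length (Lat I))

-- reduced Euler characteristic of Δ(P;μ) = {σ : μ ∉ P_σ}:
-- χ̃ = Σ_{σ ∈ Δ} (-1)^{|σ|-1} = - Σ_{σ∈Δ} (-1)^{|σ|}
redEuler : ∀ {d n} → (Subset n → List (Pt d)) → Pt d → ℤ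
redEuler {d} {n} Lat μ =
  sumℤ (allSubsets n) λ σ →
    if does (μ ∈? Lat σ) then + 0 else - sgn ∣ σ ∣
  where open DecMem (≡-dec {n = d} ℤ._≟_) using (_∈?_)

module Submission where

open import Defs
open import Data.Nat using (ℕ; _<_)
open import Data.Integer using (ℤ; _*_)
open import Data.Fin using (Fin)
open import Data.Fin.Subset using (Subset; ⊤)
open import Data.List using (List)
open import Data.List.Relation.Unary.Unique.Propositional using (Unique)
open import Data.List.Membership.Propositional using (_∈_)
open import Function.Bundles using (_⇔_)
open import Relation.Binary.PropositionalEquality using (_≡_)

open import Data.Nat as ℕ using (zero; suc; _∸_; _≤_)
import Data.Nat.Properties as ℕ
open import Data.Integer as ℤ using (+_; -_; _+_)
import Data.Integer.Properties as ℤ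
open import Data.Fin.Subset as Sub using (inside; outside; ∣_∣)
import Data.Fin.Subset.Properties as Sub
open import Data.Vec using (_∷_; lookup)
open import Data.Vec.Properties using (lookup⇒[]=; []=⇒lookup; ≡-dec)
open import Data.List as L using ([]; _∷_; length; _++_)
open import Data.List.Membership.Propositional using (_∉_)
open import Data.List.Relation.Binary.Subset.Propositional using (_⊆_)
open import Data.List.Relation.Unary.Any using (here; there)
open import Data.List.Relation.Unary.All.Properties using (All¬⇒¬Any)
open import Data.List.Relation.Unary.AllPairs using (_∷_)
open import Data.Bool using (Bool; true; false; if_then_else_)
open import Data.Product using (_,_)
open import Data.Empty using (⊥-elim)
open import Function.Bundles using (module Equivalence)
open import Relation.Nullary using (yes; no; does)
open import Relation.Binary.Definitions using (DecidableEquality)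
open import Relation.Binary.PropositionalEquality using (refl; sym; trans; cong; cong₂; module ≡-Reasoning)
open import Algebra.Properties.CommutativeSemigroup ℤ.+-commutativeSemigroup using (interchange)
import Data.List.Membership.DecPropositional as DecMembership

-- Since 0 ∈ P_i, the Minkowski sums grow with the index set, so every
-- lattice point of P_σ lies in P_[n]. Multiplying by (-1)^n turns CME into
-- Σ_σ (-1)^|σ| E(P_σ); counting each E(P_σ) over the lattice points μ of P_[n]
-- and exchanging the sums gives Σ_μ Σ_{σ : μ ∈ P_σ} (-1)^|σ|. For n > 0 the signs
-- (-1)^|σ| sum to zero over all σ ⊆ [n], so the inner sum equals
-- -Σ_{σ : μ ∉ P_σ} (-1)^|σ| = χ̃(Δ(P;μ)).

module _ {A : Set} where

  sum-cong : (xs : List A) {f g : A → ℤ} → (∀ a → f a ≡ g a) → sumℤ xs f ≡ sumℤ xs g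
  sum-cong []       f≗g = refl
  sum-cong (x ∷ xs) f≗g = cong₂ _+_ (f≗g x) (sum-cong xs f≗g)

  sum-zero : (xs : List A) → sumℤ xs (λ _ → + 0) ≡ + 0
  sum-zero []       = refl
  sum-zero (x ∷ xs) = trans (ℤ.+-identityˡ _) (sum-zero xs)

  sum-+ : (xs : List A) (f g : A → ℤ) → sumℤ xs (λ a → f a + g a) ≡ sumℤ xs f + sumℤ xs g
  sum-+ []       f g = refl
  sum-+ (x ∷ xs) f g =
    trans (cong (_+_ (f x + g x)) (sum-+ xs f g)) (interchange (f x) (g x) (sumℤ xs f) (sumℤ xs g))

  sum-* : (xs : List A) (c : ℤ) (f : A → ℤ) → sumℤ xs (λ a → c * f a) ≡ c * sumℤ xs f
  sum-* []       c f = sym (ℤ.*-zeroʳ c)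
  sum-* (x ∷ xs) c f =
    trans (cong (_+_ (c * f x)) (sum-* xs c f)) (sym (ℤ.*-distribˡ-+ c (f x) (sumℤ xs f)))

  sum-neg : (xs : List A) (f : A → ℤ) → sumℤ xs (λ a → - f a) ≡ - sumℤ xs f
  sum-neg []       f = refl
  sum-neg (x ∷ xs) f =
    trans (cong (_+_ (- f x)) (sum-neg xs f)) (sym (ℤ.neg-distrib-+ (f x) (sumℤ xs f)))

  sum-++ : (xs ys : List A) (f : A → ℤ) → sumℤ (xs ++ ys) f ≡ sumℤ xs f + sumℤ ys f
  sum-++ []       ys f = sym (ℤ.+-identityˡ _)
  sum-++ (x ∷ xs) ys f = trans (cong (_+_ (f x)) (sum-++ xs ys f)) (sym (ℤ.+-assoc (f x) _ _))

sum-map : {A B : Set} (g : A → B) (xs : List A) (f : B → ℤ) →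
  sumℤ (L.map g xs) f ≡ sumℤ xs (λ a → f (g a))
sum-map g []       f = refl
sum-map g (x ∷ xs) f = cong (_+_ (f (g x))) (sum-map g xs f)

sum-swap : {A B : Set} (xs : List A) (ys : List B) (f : A → B → ℤ) →
  sumℤ xs (λ a → sumℤ ys (f a)) ≡ sumℤ ys (λ b → sumℤ xs (λ a → f a b))
sum-swap []       ys f = sym (sum-zero ys)
sum-swap (x ∷ xs) ys f =
  trans (cong (_+_ (sumℤ ys (f x))) (sum-swap xs ys f))
        (sym (sum-+ ys (f x) (λ b → sumℤ xs (λ a → f a b))))

sgn-+ : ∀ a b → sgn (a ℕ.+ b) ≡ sgn a * sgn b
sgn-+ zero    b = sym (ℤ.*-identityˡ (sgn b))
sgn-+ (suc a) b = trans (cong -_ (sgn-+ a b)) (ℤ.neg-distribˡ-* (sgn a) (sgn b))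

sgn-square : ∀ a → sgn a * sgn a ≡ + 1
sgn-square zero    = refl
sgn-square (suc a) = begin
  - sgn a * - sgn a     ≡⟨ sym (ℤ.neg-distribˡ-* (sgn a) (- sgn a)) ⟩
  - (sgn a * - sgn a)   ≡⟨ cong -_ (sym (ℤ.neg-distribʳ-* (sgn a) (sgn a))) ⟩
  - - (sgn a * sgn a)   ≡⟨ ℤ.neg-involutive _ ⟩
  sgn a * sgn a         ≡⟨ sgn-square a ⟩
  + 1                   ∎
  where open ≡-Reasoning

sgn*sgn[∸] : ∀ n k → k ≤ n → sgn n * sgn (n ∸ k) ≡ sgn k
sgn*sgn[∸] n k k≤n = begin
  sgn n * s                   ≡⟨ cong (λ m → sgn m * s) (sym (ℕ.m+[n∸m]≡n k≤n)) ⟩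
  sgn (k ℕ.+ (n ∸ k)) * s     ≡⟨ cong (_* s) (sgn-+ k (n ∸ k)) ⟩
  sgn k * s * s               ≡⟨ ℤ.*-assoc (sgn k) s s ⟩
  sgn k * (s * s)             ≡⟨ cong (sgn k *_) (sgn-square (n ∸ k)) ⟩
  sgn k * + 1                 ≡⟨ ℤ.*-identityʳ (sgn k) ⟩
  sgn k                       ∎
  where
  open ≡-Reasoning
  s = sgn (n ∸ k)

sum-sgn-allSubsets : ∀ n → sumℤ (allSubsets (suc n)) (λ σ → sgn ∣ σ ∣) ≡ + 0
sum-sgn-allSubsets n = begin
  sumℤ (L.map (outside ∷_) S ++ L.map (inside ∷_) S) s∣_∣
    ≡⟨ sum-++ (L.map (outside ∷_) S) (L.map (inside ∷_) S) s∣_∣ ⟩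
  sumℤ (L.map (outside ∷_) S) s∣_∣ + sumℤ (L.map (inside ∷_) S) s∣_∣
    ≡⟨ cong₂ _+_ (sum-map (outside ∷_) S s∣_∣) (sum-map (inside ∷_) S s∣_∣) ⟩
  sumℤ S s∣_∣ + sumℤ S (λ σ → - sgn ∣ σ ∣)
    ≡⟨ cong (_+_ (sumℤ S s∣_∣)) (sum-neg S s∣_∣) ⟩
  sumℤ S s∣_∣ + - sumℤ S s∣_∣
    ≡⟨ ℤ.+-inverseʳ (sumℤ S s∣_∣) ⟩
  + 0 ∎
  where
  open ≡-Reasoning
  S = allSubsets n
  s∣_∣ : ∀ {m} → Subset m → ℤ
  s∣ σ ∣ = sgn ∣ σ ∣

𝟙 : Bool → ℤ
𝟙 b = if b then + 1 else + 0

module Counting {A : Set} (_≟_ : DecidableEquality A) where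
  open DecMembership _≟_ using (_∈?_)

  sum-𝟙≟-∉ : ∀ b xs → b ∉ xs → sumℤ xs (λ x → 𝟙 (does (x ≟ b))) ≡ + 0
  sum-𝟙≟-∉ b []       b∉ = refl
  sum-𝟙≟-∉ b (x ∷ xs) b∉ with x ≟ b
  ... | yes refl = ⊥-elim (b∉ (here refl))
  ... | no  _    = trans (ℤ.+-identityˡ _) (sum-𝟙≟-∉ b xs (λ b∈ → b∉ (there b∈)))

  sum-𝟙≟-∈ : ∀ b xs → Unique xs → b ∈ xs → sumℤ xs (λ x → 𝟙 (does (x ≟ b))) ≡ + 1
  sum-𝟙≟-∈ b (x ∷ xs) (x∉xs ∷ _) _ with x ≟ b
  ... | yes refl = cong (_+_ (+ 1)) (sum-𝟙≟-∉ x xs (All¬⇒¬Any x∉xs))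
  sum-𝟙≟-∈ b (x ∷ xs) (_ ∷ xs!) (here b≡x)  | no x≢b = ⊥-elim (x≢b (sym b≡x))
  sum-𝟙≟-∈ b (x ∷ xs) (_ ∷ xs!) (there b∈) | no _   = trans (ℤ.+-identityˡ _) (sum-𝟙≟-∈ b xs xs! b∈)

  𝟙∈?-∷ : ∀ b B → b ∉ B → ∀ x → 𝟙 (does (x ∈? b ∷ B)) ≡ 𝟙 (does (x ≟ b)) + 𝟙 (does (x ∈? B))
  𝟙∈?-∷ b B b∉B x with x ≟ b
  ... | no _     = sym (ℤ.+-identityˡ _)
  ... | yes refl with x ∈? B
  ...   | yes x∈B = ⊥-elim (b∉B x∈B)
  ...   | no  _   = refl

  sum-𝟙∈?-⊆ : ∀ B xs → Unique B → Unique xs → B ⊆ xs →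
    sumℤ xs (λ x → 𝟙 (does (x ∈? B))) ≡ + length B
  sum-𝟙∈?-⊆ []      xs _ _ _ = sum-zero xs
  sum-𝟙∈?-⊆ (b ∷ B) xs (b∉B ∷ B!) xs! B⊆xs = begin
    sumℤ xs (λ x → 𝟙 (does (x ∈? b ∷ B)))
      ≡⟨ sum-cong xs (𝟙∈?-∷ b B (All¬⇒¬Any b∉B)) ⟩
    sumℤ xs (λ x → 𝟙 (does (x ≟ b)) + 𝟙 (does (x ∈? B)))
      ≡⟨ sum-+ xs (λ x → 𝟙 (does (x ≟ b))) (λ x → 𝟙 (does (x ∈? B))) ⟩
    sumℤ xs (λ x → 𝟙 (does (x ≟ b))) + sumℤ xs (λ x → 𝟙 (does (x ∈? B)))
      ≡⟨ cong₂ _+_ (sum-𝟙≟-∈ b xs xs! (B⊆xs (here refl)))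
                   (sum-𝟙∈?-⊆ B xs B! xs! (λ x∈B → B⊆xs (there x∈B))) ⟩
    + 1 + + length B ∎
    where open ≡-Reasoning

-- The points p_i with i ∉ σ are replaced by 0 ∈ P_i.
InMinkowski-mono : ∀ {d n} (P : Fin n → List (Pt d)) → (∀ i → InConv (P i) zeroQ) →
  {σ τ : Subset n} → σ Sub.⊆ τ → (x : QPt d) → InMinkowski P σ x → InMinkowski P τ x
InMinkowski-mono {d} {n} P 0∈P {σ} {τ} σ⊆τ x (p , p∈P , Σp≡x) =
  p′ , p′∈P , trans (sumQ-cong restrict) Σp≡x
  where
  p′ : Fin n → QPt d
  p′ i = if lookup σ i then p i else zeroQ

  p′∈P : ∀ i → i Sub.∈ τ → InConv (P i) (p′ i)
  p′∈P i _ with lookup σ i in i∈σ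
  ... | true  = p∈P i (lookup⇒[]= i σ i∈σ)
  ... | false = 0∈P i

  restrict : ∀ i → (if lookup τ i then p′ i else zeroQ) ≡ (if lookup σ i then p i else zeroQ)
  restrict i with lookup σ i in i∈σ
  ... | true  rewrite []=⇒lookup (σ⊆τ (lookup⇒[]= i σ i∈σ)) = refl
  ... | false with lookup τ i
  ...   | true  = refl
  ...   | false = refl

  sumQ-cong : ∀ {k} {f g : Fin k → QPt d} → (∀ i → f i ≡ g i) → sumQ f ≡ sumQ g
  sumQ-cong {zero}  f≗g = refl
  sumQ-cong {suc k} f≗g = cong₂ _+Q_ (f≗g Fin.zero) (sumQ-cong (λ j → f≗g (Fin.suc j)))

alternatingCount : ∀ {d n} → (Subset n → List (Pt d)) → ℤ
alternatingCount {n = n} Lat = sumℤ (allSubsets n) λ σ → sgn ∣ σ ∣ * + length (Lat σ)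

sgn*CME≡alternatingCount : ∀ {d n} (Lat : Subset n → List (Pt d)) →
  sgn n * CME Lat ≡ alternatingCount Lat
sgn*CME≡alternatingCount {n = n} Lat = begin
  sgn n * CME Lat
    ≡⟨ sym (sum-* S (sgn n) (λ σ → sgn (n ∸ ∣ σ ∣) * + length (Lat σ))) ⟩
  sumℤ S (λ σ → sgn n * (sgn (n ∸ ∣ σ ∣) * + length (Lat σ)))
    ≡⟨ sum-cong S (λ σ → trans (sym (ℤ.*-assoc (sgn n) _ _))
                               (cong (_* + length (Lat σ)) (sgn*sgn[∸] n ∣ σ ∣ (Sub.∣p∣≤n σ)))) ⟩
  alternatingCount Lat ∎
  where
  open ≡-Reasoning
  S = allSubsets n

if-then-0-else-neg : ∀ b s → (if b then + 0 else - s) ≡ - s + s * 𝟙 b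
if-then-0-else-neg true  s = trans (sym (ℤ.+-inverseˡ s)) (cong (_+_ (- s)) (sym (ℤ.*-identityʳ s)))
if-then-0-else-neg false s = sym (trans (cong (_+_ (- s)) (ℤ.*-zeroʳ s)) (ℤ.+-identityʳ (- s)))

module _ {d : ℕ} where
  open DecMembership (≡-dec {n = d} ℤ._≟_) using (_∈?_)

  redEuler≡signedIncidence : ∀ {n} (Lat : Subset (suc n) → List (Pt d)) μ →
    redEuler Lat μ ≡ sumℤ (allSubsets (suc n)) λ σ → sgn ∣ σ ∣ * 𝟙 (does (μ ∈? Lat σ))
  redEuler≡signedIncidence {n} Lat μ = begin
    redEuler Lat μ
      ≡⟨ sum-cong S (λ σ → if-then-0-else-neg (does (μ ∈? Lat σ)) (sgn ∣ σ ∣)) ⟩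
    sumℤ S (λ σ → - sgn ∣ σ ∣ + incidence σ)
      ≡⟨ sum-+ S (λ σ → - sgn ∣ σ ∣) incidence ⟩
    sumℤ S (λ σ → - sgn ∣ σ ∣) + sumℤ S incidence
      ≡⟨ cong (_+ sumℤ S incidence)
              (trans (sum-neg S (λ σ → sgn ∣ σ ∣)) (cong -_ (sum-sgn-allSubsets n))) ⟩
    + 0 + sumℤ S incidence
      ≡⟨ ℤ.+-identityˡ _ ⟩
    sumℤ S incidence ∎
    where
    open ≡-Reasoning
    S = allSubsets (suc n)
    incidence : Subset (suc n) → ℤ
    incidence σ = sgn ∣ σ ∣ * 𝟙 (does (μ ∈? Lat σ))

theorem1 : ∀ {d n : ℕ} → 0 < n →
    (P : Fin n → List (Pt d)) →
    (∀ i → InConv (P i) zeroQ) →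
    (Lat : Subset n → List (Pt d)) →
    (∀ I → Unique (Lat I)) →
    (∀ I (x : Pt d) → (x ∈ Lat I) ⇔ InMinkowski P I (toℚ x)) →
    sgn n * CME Lat ≡ sumℤ (Lat ⊤) (redEuler Lat)
theorem1 {d} {suc k} _ P 0∈P Lat Lat! Lat⇔P = begin
  sgn n * CME Lat
    ≡⟨ sgn*CME≡alternatingCount Lat ⟩
  alternatingCount Lat
    ≡⟨ sum-cong S (λ σ → trans (cong (sgn ∣ σ ∣ *_) (sym (E[P_σ]≡count σ)))
                               (sym (sum-* (Lat ⊤) (sgn ∣ σ ∣) (λ μ → 𝟙 (does (μ ∈? Lat σ)))))) ⟩
  sumℤ S (λ σ → sumℤ (Lat ⊤) (λ μ → sgn ∣ σ ∣ * 𝟙 (does (μ ∈? Lat σ))))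
    ≡⟨ sum-swap S (Lat ⊤) (λ σ μ → sgn ∣ σ ∣ * 𝟙 (does (μ ∈? Lat σ))) ⟩
  sumℤ (Lat ⊤) (λ μ → sumℤ S (λ σ → sgn ∣ σ ∣ * 𝟙 (does (μ ∈? Lat σ))))
    ≡⟨ sum-cong (Lat ⊤) (λ μ → sym (redEuler≡signedIncidence Lat μ)) ⟩
  sumℤ (Lat ⊤) (redEuler Lat) ∎
  where
  open ≡-Reasoning
  open DecMembership (≡-dec {n = d} ℤ._≟_) using (_∈?_)
  open Counting (≡-dec {n = d} ℤ._≟_) using (sum-𝟙∈?-⊆)
  n = suc k
  S = allSubsets n

  Lat-mono : ∀ σ → Lat σ ⊆ Lat ⊤
  Lat-mono σ {x} x∈ = Equivalence.from (Lat⇔P ⊤ x)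
    (InMinkowski-mono P 0∈P (Sub.⊆⊤ {p = σ}) (toℚ x) (Equivalence.to (Lat⇔P σ x) x∈))

  E[P_σ]≡count : ∀ σ → sumℤ (Lat ⊤) (λ μ → 𝟙 (does (μ ∈? Lat σ))) ≡ + length (Lat σ)
  E[P_σ]≡count σ = sum-𝟙∈?-⊆ (Lat σ) (Lat ⊤) (Lat! σ) (Lat! ⊤) (Lat-mono σ)
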